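{- Let $G$ be a graph of order $n$ and let $w$ be a support vertex of $G$ whose set of leaf neighbors is $L_G(w)=\{v_1,\dots,v_t\}$ for some integer $t\geq 1$. Let $H$ be the subgraph of $G$ induced by $V(G)\setminus(L_G(w)\cup\{w\})$. Suppose that every vertex of $N_G(w)\setminus L_G(w)$ is a support vertex of $G$, and that $3D'_H(1)\leq 2(n-t-1)D_H(1)$. Then $$3D'_G(1)\leq 2nD_G(1),$$ with equality if and only if $t\in\{1,2\}$ and $3D'_H(1)=2(n-t-1)D_H(1)$.
   Context: All graphs are finite, simple and undirected. A set $S\subseteq V(G)$ is a dominating set of $G$ if every vertex of $V(G)\setminus S$ is adjacent to some vertex of $S$. The domination polynomial of $G$ is $D_G(x)=\sum_{S}x^{|S|}$, the sum over all dominating sets $S$ of $G$ (for the graph with no vertices, $D(x)=1$); $D'_G$ denotes its derivative. $N_G(w)$ is the set of neighbors of $w$. A leaf is a vertex of degree one; a support vertex is a vertex adjacent to a leaf; $L_G(w)$ is the set of leaf neighbors of $w$. -}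

module Defs where

open import Data.Nat using (ℕ; zero; suc; _+_)
open import Data.Bool using (Bool; true; false; _∧_; _∨_; not; if_then_else_)
open import Data.Fin using (Fin; zero; suc)
open import Data.Vec using (Vec; []; _∷_; lookup; tabulate)
open import Data.List using (List; []; _∷_; _++_; map; filter; length)
open import Data.Nat.ListAction using (sum)
open import Data.Product using (_×_; ∃)
open import Relation.Binary.PropositionalEquality using (_≡_)
open import Relation.Nullary using (¬_)
open import Data.Bool.Properties using (T?)

record Graph (n : ℕ) : Set where
  field
    adj    : Fin n → Fin n → Bool
    sym    : ∀ u v → adj u v ≡ adj v u
    irrefl : ∀ v → adj v v ≡ false
open Graph public

VSet : ℕ → Set
VSet n = Vec Bool n

allF : ∀ {n} → (Fin n → Bool) → Bool
allF {zero}  f = true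
allF {suc n} f = f zero ∧ allF (λ i → f (suc i))

anyF : ∀ {n} → (Fin n → Bool) → Bool
anyF {zero}  f = false
anyF {suc n} f = f zero ∨ anyF (λ i → f (suc i))

countF : ∀ {n} → (Fin n → Bool) → ℕ
countF {zero}  f = 0
countF {suc n} f = (if f zero then 1 else 0) + countF (λ i → f (suc i))

card : ∀ {n} → VSet n → ℕ
card S = countF (lookup S)

allSubsets : ∀ n → List (VSet n)
allSubsets zero    = [] ∷ []
allSubsets (suc n) = map (true ∷_) (allSubsets n) ++ map (false ∷_) (allSubsets n)

degree : ∀ {n} → Graph n → Fin n → ℕ
degree G v = countF (adj G v)

isLeafB : ∀ {n} → Graph n → Fin n → Bool
isLeafB G v with degree G v
... | 1 = true
... | _ = false

IsLeaf : ∀ {n} → Graph n → Fin n → Set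
IsLeaf G v = degree G v ≡ 1

IsSupport : ∀ {n} → Graph n → Fin n → Set
IsSupport G w = ∃ λ v → adj G w v ≡ true × IsLeaf G v

leafNbrs : ∀ {n} → Graph n → Fin n → VSet n
leafNbrs G w = tabulate (λ v → adj G w v ∧ isLeafB G v)

-- Dominating sets of the induced subgraph G[U]:
-- S ⊆ U and every vertex of U ∖ S has a neighbour in S.
isDomIn : ∀ {n} → Graph n → VSet n → VSet n → Bool
isDomIn G U S =
  allF (λ v → not (lookup S v) ∨ lookup U v) ∧
  allF (λ u → not (lookup U u) ∨ lookup S u ∨
               anyF (λ v → lookup S v ∧ adj G u v))

domSetsIn : ∀ {n} → Graph n → VSet n → List (VSet n)
domSetsIn G U = filter (λ S → T? (isDomIn G U S)) (allSubsets _)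

-- D_{G[U]}(1) = number of dominating sets; D'_{G[U]}(1) = Σ |S| over them.
D1In : ∀ {n} → Graph n → VSet n → ℕ
D1In G U = length (domSetsIn G U)

D'1In : ∀ {n} → Graph n → VSet n → ℕ
D'1In G U = sum (map card (domSetsIn G U))

fullSet : ∀ {n} → VSet n
fullSet = tabulate (λ _ → true)

D1 : ∀ {n} → Graph n → ℕ
D1 G = D1In G fullSet

D'1 : ∀ {n} → Graph n → ℕ
D'1 G = D'1In G fullSet

restVerts : ∀ {n} → Graph n → Fin n → VSet n
restVerts {n} G w = tabulate (λ v → not (lookup (leafNbrs G w) v) ∧ not (eqF v w))
  where
  eqF : ∀ {m} → Fin m → Fin m → Bool
  eqF zero zero = true
  eqF (suc a) (suc b) = eqF a b
  eqF _ _ = false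

module Submission where

-- Write K = L_G(w) and M = V(H). A set S dominates G exactly when S ∩ M dominates H and
-- S ∖ M dominates the star on K ∪ {w}: a vertex of H dominated only by w is a non-leaf
-- neighbour of w, hence a support vertex, and its leaf is then a vertex of S ∩ M next to it.
-- So D_G(1) = D_H(1) c and D'_G(1) = D'_H(1) c + D_H(1) c', where c = 2^t + 1 and c' are
-- the number and the total size of the dominating sets of the star K_{1,t}. The bound
-- 3 c' ≤ 2 (t + 1) c, tight exactly for t ∈ {1, 2}, then combines with the hypothesis on H
-- as in the product rule (D_H D_{K_{1,t}})' = D'_H D_{K_{1,t}} + D_H D'_{K_{1,t}}.

import Algebra.Properties.CommutativeSemigroup as CommutativeSemigroupProperties
open import Data.Bool using (Bool; true; false; T; not; _∧_; _∨_; if_then_else_)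
open import Data.Bool.Properties using (T?; T-≡; T-∧; T-∨; ∧-zeroʳ; ∧-identityʳ; not-involutive)
open import Data.Empty using (⊥-elim)
open import Data.Fin using (Fin; zero; suc; _≟_)
open import Data.Fin.Subset using (∁; _∩_; _─_)
open import Data.List using ([]; _∷_; map; filter; length; _++_)
open import Data.List.Properties using (map-++; map-∘)
open import Data.Nat using (ℕ; zero; suc; pred; _+_; _*_; _∸_; _^_; _≤_; _<_; _≥_; z≤n; s≤s; NonZero; >-nonZero)
open import Data.Nat.ListAction using (sum)
open import Data.Nat.ListAction.Properties using (sum-++)
open import Data.Nat.Properties
  using (+-identityʳ; +-suc; +-comm; +-commutativeSemigroup; +-mono-≤; +-monoʳ-≤; +-cancelˡ-≡; +-cancelʳ-≤;
         *-identityʳ; *-assoc; *-distribʳ-+; *-distribˡ-+; *-monoˡ-≤; *-monoʳ-≤; *-cancelʳ-≡; *-cancelˡ-≡; *-cancelˡ-<;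
         ≤-refl; ≤-reflexive; ≤-trans; ≤-antisym; <⇒≤; <⇒≢; 1+n≰n; m≤m+n; m≤n+m; m≤n⇒m≤1+n; m<m+n;
         m^n≢0; suc-pred; ∸-+-assoc; m∸n+n≡m)
open import Data.Nat.Tactic.RingSolver using (solve-∀)
open import Data.Product using (_×_; _,_; proj₁; proj₂; ∃)
open import Data.Sum using (_⊎_; inj₁; inj₂; map₂)
open import Data.Unit using (tt)
open import Data.Vec using ([]; _∷_; lookup; tabulate; _[_]≔_)
open import Data.Vec.Properties using (lookup∘tabulate; lookup-zipWith; lookup-map; lookup∘update; lookup∘update′)
open import Data.Vec.Relation.Binary.Pointwise.Extensional using (ext; Pointwise-≡⇒≡)
open import Function using (_∘_; _⇔_; mk⇔; Equivalence)
open import Relation.Binary.PropositionalEquality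
open import Relation.Nullary using (¬_; Dec; yes; no; does)

open import Defs hiding (sym)

open Equivalence using (to; from)
open CommutativeSemigroupProperties +-commutativeSemigroup using () renaming (interchange to +-interchange)

T-not-∨ : ∀ {a b} → T (not a ∨ b) ⇔ (T a → T b)
T-not-∨ {true} = mk⇔ (λ tb _ → tb) (λ f → f tt)
T-not-∨ {false} = mk⇔ (λ _ ()) (λ _ → tt)

T-injective : ∀ {a b} → T a ⇔ T b → a ≡ b
T-injective {true} {true} _ = refl
T-injective {true} {false} e = ⊥-elim (to e tt)
T-injective {false} {true} e = ⊥-elim (from e tt)
T-injective {false} {false} _ = refl

T-allF : ∀ {n} {f : Fin n → Bool} → T (allF f) ⇔ (∀ i → T (f i))
T-allF {zero} = mk⇔ (λ _ ()) (λ _ → tt)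
T-allF {suc n} {f} = mk⇔ to′ (λ h → from T-∧ (h zero , from T-allF (h ∘ suc)))
  where
  to′ : T (allF f) → ∀ i → T (f i)
  to′ h zero = proj₁ (to T-∧ h)
  to′ h (suc i) = to T-allF (proj₂ (to T-∧ h)) i

T-anyF : ∀ {n} {f : Fin n → Bool} → T (anyF f) ⇔ ∃ λ i → T (f i)
T-anyF {zero} = mk⇔ (λ ()) (λ ())
T-anyF {suc n} {f} = mk⇔ to′ from′
  where
  to′ : T (anyF f) → ∃ λ i → T (f i)
  to′ h with to T-∨ h
  ... | inj₁ h₀ = zero , h₀
  ... | inj₂ hₛ with to T-anyF hₛ
  ...   | i , hᵢ = suc i , hᵢ
  from′ : (∃ λ i → T (f i)) → T (anyF f)
  from′ (zero , h₀) = from T-∨ (inj₁ h₀)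
  from′ (suc i , hᵢ) = from T-∨ (inj₂ (from T-anyF (i , hᵢ)))

⟦_⟧ : Bool → ℕ
⟦ b ⟧ = if b then 1 else 0

¬T⇒≡false : ∀ {b} → ¬ T b → b ≡ false
¬T⇒≡false {true} ¬b = ⊥-elim (¬b tt)
¬T⇒≡false {false} _ = refl

⟦⟧-false : ∀ {b} → ¬ T b → ⟦ b ⟧ ≡ 0
⟦⟧-false ¬b = cong ⟦_⟧ (¬T⇒≡false ¬b)

⟦∧⟧ : ∀ a b → ⟦ a ∧ b ⟧ ≡ ⟦ a ⟧ * ⟦ b ⟧
⟦∧⟧ true b = sym (+-identityʳ ⟦ b ⟧)
⟦∧⟧ false b = refl

countF-pos : ∀ {n} (f : Fin n → Bool) {i} → T (f i) → 1 ≤ countF f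
countF-pos f {zero} p with f zero
... | true = s≤s z≤n
countF-pos f {suc i} p = ≤-trans (countF-pos (f ∘ suc) p) (m≤n+m _ ⟦ f zero ⟧)

countF-≥2 : ∀ {n} (f : Fin n → Bool) {i j} → T (f i) → T (f j) → i ≢ j → 2 ≤ countF f
countF-≥2 f {zero} {zero} _ _ i≢j = ⊥-elim (i≢j refl)
countF-≥2 f {zero} {suc j} p q _ with f zero
... | true = s≤s (countF-pos (f ∘ suc) q)
countF-≥2 f {suc i} {zero} p q _ with f zero
... | true = s≤s (countF-pos (f ∘ suc) p)
countF-≥2 f {suc i} {suc j} p q i≢j =
  ≤-trans (countF-≥2 (f ∘ suc) p q (i≢j ∘ cong suc)) (m≤n+m _ ⟦ f zero ⟧)

countF≡1-unique : ∀ {n} (f : Fin n → Bool) → countF f ≡ 1 → ∀ {i j} → T (f i) → T (f j) → i ≡ j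
countF≡1-unique f c {i} {j} p q with i ≟ j
... | yes i≡j = i≡j
... | no i≢j = ⊥-elim (1+n≰n (subst (2 ≤_) c (countF-≥2 f p q i≢j)))

countF-witness : ∀ {n} (f : Fin n → Bool) → 1 ≤ countF f → ∃ λ i → T (f i)
countF-witness {suc n} f p with f zero in f₀
... | true = zero , subst T (sym f₀) tt
... | false with countF-witness (f ∘ suc) p
...   | i , q = suc i , q

infix 4 _∈_ _∉_ _∈?_ _⊆_
infix 7 _⊆ᵇ_

_∈_ : ∀ {n} → Fin n → VSet n → Set
v ∈ S = T (lookup S v)

_∉_ : ∀ {n} → Fin n → VSet n → Set
v ∉ S = ¬ v ∈ S

_∈?_ : ∀ {n} (v : Fin n) (S : VSet n) → Dec (v ∈ S)
v ∈? S = T? (lookup S v)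

_⊆_ : ∀ {n} → VSet n → VSet n → Set
A ⊆ B = ∀ {v} → v ∈ A → v ∈ B

_⊆ᵇ_ : ∀ {n} → VSet n → VSet n → Bool
A ⊆ᵇ B = allF (λ v → not (lookup A v) ∨ lookup B v)

T-⊆ᵇ : ∀ {n} {A B : VSet n} → T (A ⊆ᵇ B) ⇔ A ⊆ B
T-⊆ᵇ {A = A} {B} = mk⇔
  (λ h {v} → to (T-not-∨ {lookup A v}) (to T-allF h v))
  (λ h → from T-allF (λ v → from (T-not-∨ {lookup A v}) h))

∈-fullSet : ∀ {n} (v : Fin n) → v ∈ fullSet
∈-fullSet v = subst T (sym (lookup∘tabulate (λ _ → true) v)) tt

∈-∩ : ∀ {n} (S M : VSet n) {v} → v ∈ S ∩ M ⇔ (v ∈ S × v ∈ M)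
∈-∩ S M {v} = subst (λ b → T b ⇔ (v ∈ S × v ∈ M)) (sym (lookup-zipWith _∧_ v S M)) T-∧

lookup-─ : ∀ {n} (S M : VSet n) v → lookup (S ─ M) v ≡ lookup S v ∧ not (lookup M v)
lookup-─ (s ∷ S) (true ∷ M) zero = sym (∧-zeroʳ s)
lookup-─ (s ∷ S) (false ∷ M) zero = sym (∧-identityʳ s)
lookup-─ (_ ∷ S) (_ ∷ M) (suc v) = lookup-─ S M v

∈-─ : ∀ {n} (S M : VSet n) {v} → v ∈ S ─ M ⇔ (v ∈ S × v ∉ M)
∈-─ S M {v} = subst (λ b → T b ⇔ (v ∈ S × v ∉ M)) (sym (lookup-─ S M v)) (T-∧-not {lookup S v})
  where
  T-∧-not : ∀ {a b} → T (a ∧ not b) ⇔ (T a × ¬ T b)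
  T-∧-not {a} {true} = mk⇔ (λ x → ⊥-elim (subst T (∧-zeroʳ a) x)) (λ (_ , ¬b) → ⊥-elim (¬b tt))
  T-∧-not {a} {false} = mk⇔ (λ x → subst T (∧-identityʳ a) x , λ ()) (λ (x , _) → subst T (sym (∧-identityʳ a)) x)

p∩q⊆p : ∀ {n} (S M : VSet n) → S ∩ M ⊆ S
p∩q⊆p S M v∈S∩M = proj₁ (to (∈-∩ S M) v∈S∩M)

p─q⊆p : ∀ {n} (S M : VSet n) → S ─ M ⊆ S
p─q⊆p S M v∈S─M = proj₁ (to (∈-─ S M) v∈S─M)

∑⊆ : ∀ {n} → VSet n → (VSet n → ℕ) → ℕ
∑⊆ [] f = f []
∑⊆ (true ∷ U) f = ∑⊆ U (f ∘ (true ∷_)) + ∑⊆ U (f ∘ (false ∷_))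
∑⊆ (false ∷ U) f = ∑⊆ U (f ∘ (false ∷_))

sum-allSubsets : ∀ n (f : VSet n → ℕ) → sum (map f (allSubsets n)) ≡ ∑⊆ fullSet f
sum-allSubsets zero f = +-identityʳ (f [])
sum-allSubsets (suc n) f = begin
  sum (map f (map (true ∷_) Ss ++ map (false ∷_) Ss))
    ≡⟨ cong sum (map-++ f (map (true ∷_) Ss) _) ⟩
  sum (map f (map (true ∷_) Ss) ++ map f (map (false ∷_) Ss))
    ≡⟨ sum-++ (map f (map (true ∷_) Ss)) _ ⟩
  sum (map f (map (true ∷_) Ss)) + sum (map f (map (false ∷_) Ss))
    ≡⟨ cong₂ _+_ (cong sum (sym (map-∘ Ss))) (cong sum (sym (map-∘ Ss))) ⟩
  sum (map (f ∘ (true ∷_)) Ss) + sum (map (f ∘ (false ∷_)) Ss)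
    ≡⟨ cong₂ _+_ (sum-allSubsets n _) (sum-allSubsets n _) ⟩
  ∑⊆ fullSet f ∎
  where
  open ≡-Reasoning
  Ss = allSubsets n

∑⊆-cong : ∀ {n} (U : VSet n) {f g : VSet n → ℕ} → (∀ {A} → A ⊆ U → f A ≡ g A) → ∑⊆ U f ≡ ∑⊆ U g
∑⊆-cong [] f≗g = f≗g (λ { {()} })
∑⊆-cong (true ∷ U) f≗g =
  cong₂ _+_ (∑⊆-cong U λ {A} A⊆U → f≗g (λ {v} → ∷-⊆ {true} {A} A⊆U {v}))
            (∑⊆-cong U λ {A} A⊆U → f≗g (λ {v} → ∷-⊆ {false} {A} A⊆U {v}))
  where
  ∷-⊆ : ∀ {b A} → A ⊆ U → b ∷ A ⊆ true ∷ U
  ∷-⊆ A⊆U {zero} _ = tt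
  ∷-⊆ A⊆U {suc v} v∈A = A⊆U v∈A
∑⊆-cong (false ∷ U) f≗g = ∑⊆-cong U λ {A} A⊆U → f≗g (λ {v} → false∷-⊆ {A} A⊆U {v})
  where
  false∷-⊆ : ∀ {A} → A ⊆ U → false ∷ A ⊆ false ∷ U
  false∷-⊆ A⊆U {suc v} v∈A = A⊆U v∈A

∑⊆-zero : ∀ {n} (U : VSet n) {f : VSet n → ℕ} → (∀ A → f A ≡ 0) → ∑⊆ U f ≡ 0
∑⊆-zero [] f≗0 = f≗0 []
∑⊆-zero (true ∷ U) f≗0 = cong₂ _+_ (∑⊆-zero U (f≗0 ∘ (true ∷_))) (∑⊆-zero U (f≗0 ∘ (false ∷_)))
∑⊆-zero (false ∷ U) f≗0 = ∑⊆-zero U (f≗0 ∘ (false ∷_))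

∑⊆-+ : ∀ {n} (U : VSet n) (f g : VSet n → ℕ) → ∑⊆ U (λ A → f A + g A) ≡ ∑⊆ U f + ∑⊆ U g
∑⊆-+ [] f g = refl
∑⊆-+ (true ∷ U) f g = trans (cong₂ _+_ (∑⊆-+ U _ _) (∑⊆-+ U _ _))
  (+-interchange (∑⊆ U (f ∘ (true ∷_))) (∑⊆ U (g ∘ (true ∷_))) (∑⊆ U (f ∘ (false ∷_))) (∑⊆ U (g ∘ (false ∷_))))
∑⊆-+ (false ∷ U) f g = ∑⊆-+ U _ _

∑⊆-restrict : ∀ {n} (U : VSet n) (f : VSet n → ℕ) →
  (∀ {A v} → v ∈ A → v ∉ U → f A ≡ 0) → ∑⊆ fullSet f ≡ ∑⊆ U f
∑⊆-restrict [] f f₀ = refl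
∑⊆-restrict (true ∷ U) f f₀ =
  cong₂ _+_ (∑⊆-restrict U _ λ {_} {v} → f₀ {v = suc v}) (∑⊆-restrict U _ λ {_} {v} → f₀ {v = suc v})
∑⊆-restrict (false ∷ U) f f₀ = begin
  ∑⊆ fullSet (f ∘ (true ∷_)) + ∑⊆ fullSet (f ∘ (false ∷_))
    ≡⟨ cong (_+ ∑⊆ fullSet (f ∘ (false ∷_))) (∑⊆-zero fullSet (λ A → f₀ {A = true ∷ A} {v = zero} tt λ ())) ⟩
  ∑⊆ fullSet (f ∘ (false ∷_))
    ≡⟨ ∑⊆-restrict U _ (λ {_} {v} → f₀ {v = suc v}) ⟩
  ∑⊆ U (f ∘ (false ∷_)) ∎
  where open ≡-Reasoning

∑⊆-≥ : ∀ {n} (U : VSet n) (f : VSet n → ℕ) {A} → A ⊆ U → f A ≤ ∑⊆ U f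
∑⊆-≥ [] f {[]} _ = ≤-refl
∑⊆-≥ (true ∷ U) f {true ∷ A} A⊆U = ≤-trans (∑⊆-≥ U (f ∘ (true ∷_)) (λ {v} → A⊆U {suc v})) (m≤m+n _ _)
∑⊆-≥ (true ∷ U) f {false ∷ A} A⊆U = ≤-trans (∑⊆-≥ U (f ∘ (false ∷_)) (λ {v} → A⊆U {suc v})) (m≤n+m _ _)
∑⊆-≥ (false ∷ U) f {true ∷ A} A⊆U = ⊥-elim (A⊆U {zero} tt)
∑⊆-≥ (false ∷ U) f {false ∷ A} A⊆U = ∑⊆-≥ U (f ∘ (false ∷_)) (λ {v} → A⊆U {suc v})

∑⊆-∩-─ : ∀ {n} (M : VSet n) (f g : VSet n → ℕ) →
  ∑⊆ fullSet (λ S → f (S ∩ M) * g (S ─ M)) ≡ ∑⊆ M f * ∑⊆ (∁ M) g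
∑⊆-∩-─ [] f g = refl
∑⊆-∩-─ (true ∷ M) f g =
  trans (cong₂ _+_ (∑⊆-∩-─ M _ _) (∑⊆-∩-─ M _ _))
    (sym (*-distribʳ-+ (∑⊆ (∁ M) (g ∘ (false ∷_))) (∑⊆ M (f ∘ (true ∷_))) (∑⊆ M (f ∘ (false ∷_)))))
∑⊆-∩-─ (false ∷ M) f g =
  trans (cong₂ _+_ (∑⊆-∩-─ M _ _) (∑⊆-∩-─ M _ _))
    (sym (*-distribˡ-+ (∑⊆ M (f ∘ (false ∷_))) (∑⊆ (∁ M) (g ∘ (true ∷_))) (∑⊆ (∁ M) (g ∘ (false ∷_)))))

∑⊆-1 : ∀ {n} (U : VSet n) → ∑⊆ U (λ _ → 1) ≡ 2 ^ card U
∑⊆-1 [] = refl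
∑⊆-1 (true ∷ U) = trans (cong₂ _+_ (∑⊆-1 U) (∑⊆-1 U)) (cong (2 ^ card U +_) (sym (+-identityʳ _)))
∑⊆-1 (false ∷ U) = ∑⊆-1 U

∑⊆-card : ∀ {n} (U : VSet n) → 2 * ∑⊆ U card ≡ card U * 2 ^ card U
∑⊆-card [] = refl
∑⊆-card (false ∷ U) = ∑⊆-card U
∑⊆-card (true ∷ U) = begin
  2 * (∑⊆ U (λ A → 1 + card A) + ∑⊆ U card)
    ≡⟨ cong (λ s → 2 * (s + ∑⊆ U card)) (∑⊆-+ U (λ _ → 1) card) ⟩
  2 * (∑⊆ U (λ _ → 1) + ∑⊆ U card + ∑⊆ U card)
    ≡⟨ cong (λ s → 2 * (s + ∑⊆ U card + ∑⊆ U card)) (∑⊆-1 U) ⟩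
  2 * (2 ^ card U + ∑⊆ U card + ∑⊆ U card)
    ≡⟨ regroup (2 ^ card U) (∑⊆ U card) ⟩
  2 * 2 ^ card U + 2 * (2 * ∑⊆ U card)
    ≡⟨ cong (λ s → 2 * 2 ^ card U + 2 * s) (∑⊆-card U) ⟩
  2 * 2 ^ card U + 2 * (card U * 2 ^ card U)
    ≡⟨ factor (card U) (2 ^ card U) ⟩
  suc (card U) * 2 ^ suc (card U) ∎
  where
  open ≡-Reasoning
  regroup : ∀ p x → 2 * (p + x + x) ≡ 2 * p + 2 * (2 * x)
  regroup = solve-∀
  factor : ∀ m p → 2 * p + 2 * (m * p) ≡ suc m * (2 * p)
  factor = solve-∀

∑⊆-⊇ : ∀ {n} (U : VSet n) (f : VSet n → ℕ) → ∑⊆ U (λ A → ⟦ U ⊆ᵇ A ⟧ * f A) ≡ f U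
∑⊆-⊇ [] f = +-identityʳ (f [])
∑⊆-⊇ (true ∷ U) f =
  trans (cong₂ _+_ (∑⊆-⊇ U (f ∘ (true ∷_))) (∑⊆-zero U λ _ → refl)) (+-identityʳ _)
∑⊆-⊇ (false ∷ U) f = ∑⊆-⊇ U (f ∘ (false ∷_))

∑⊆-insert : ∀ {n} (U : VSet n) (p : Fin n) (f : VSet n → ℕ) → p ∉ U →
  ∑⊆ (U [ p ]≔ true) f ≡ ∑⊆ U (λ A → f (A [ p ]≔ true)) + ∑⊆ U f
∑⊆-insert (true ∷ U) zero f p∉U = ⊥-elim (p∉U tt)
∑⊆-insert (false ∷ U) zero f p∉U = refl
∑⊆-insert (false ∷ U) (suc p) f p∉U = ∑⊆-insert U p (f ∘ (false ∷_)) p∉U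
∑⊆-insert (true ∷ U) (suc p) f p∉U =
  trans (cong₂ _+_ (∑⊆-insert U p (f ∘ (true ∷_)) p∉U) (∑⊆-insert U p (f ∘ (false ∷_)) p∉U))
    (+-interchange (∑⊆ U (λ A → f (true ∷ A [ p ]≔ true))) (∑⊆ U (f ∘ (true ∷_)))
                 (∑⊆ U (λ A → f (false ∷ A [ p ]≔ true))) (∑⊆ U (f ∘ (false ∷_))))

card-insert : ∀ {n} (A : VSet n) (p : Fin n) → p ∉ A → card (A [ p ]≔ true) ≡ suc (card A)
card-insert (true ∷ A) zero p∉A = ⊥-elim (p∉A tt)
card-insert (false ∷ A) zero p∉A = refl
card-insert (true ∷ A) (suc p) p∉A = cong suc (card-insert A p p∉A)
card-insert (false ∷ A) (suc p) p∉A = card-insert A p p∉A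

card-∩-─ : ∀ {n} (S M : VSet n) → card S ≡ card (S ∩ M) + card (S ─ M)
card-∩-─ [] [] = refl
card-∩-─ (true ∷ S) (true ∷ M) = cong suc (card-∩-─ S M)
card-∩-─ (true ∷ S) (false ∷ M) = trans (cong suc (card-∩-─ S M)) (sym (+-suc _ _))
card-∩-─ (false ∷ S) (true ∷ M) = card-∩-─ S M
card-∩-─ (false ∷ S) (false ∷ M) = card-∩-─ S M

card-< : ∀ {n} (K : VSet n) {p : Fin n} → p ∉ K → suc (card K) ≤ n
card-< (true ∷ K) {zero} p∉K = ⊥-elim (p∉K tt)
card-< (false ∷ K) {zero} _ = s≤s (card≤ K)
  where
  card≤ : ∀ {m} (A : VSet m) → card A ≤ m
  card≤ [] = z≤n
  card≤ (true ∷ A) = s≤s (card≤ A)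
  card≤ (false ∷ A) = m≤n⇒m≤1+n (card≤ A)
card-< (true ∷ K) {suc p} p∉K = s≤s (card-< K p∉K)
card-< (false ∷ K) {suc p} p∉K = m≤n⇒m≤1+n (card-< K p∉K)

length-filter : ∀ {A : Set} (p : A → Bool) xs → length (filter (λ x → T? (p x)) xs) ≡ sum (map (⟦_⟧ ∘ p) xs)
length-filter p [] = refl
length-filter p (x ∷ xs) with p x
... | true = cong suc (length-filter p xs)
... | false = length-filter p xs

sum-map-filter : ∀ {A : Set} (p : A → Bool) (f : A → ℕ) xs →
  sum (map f (filter (λ x → T? (p x)) xs)) ≡ sum (map (λ x → ⟦ p x ⟧ * f x) xs)
sum-map-filter p f [] = refl
sum-map-filter p f (x ∷ xs) with p x
... | true = cong₂ _+_ (sym (+-identityʳ (f x))) (sum-map-filter p f xs)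
... | false = sum-map-filter p f xs

data Dominated {n} (G : Graph n) (S : VSet n) (u : Fin n) : Set where
  member : u ∈ S → Dominated G S u
  adjacent : ∀ {v} → v ∈ S → T (adj G u v) → Dominated G S u

Dominating : ∀ {n} → Graph n → VSet n → Set
Dominating G S = ∀ u → Dominated G S u

T-dominated : ∀ {n} {G : Graph n} {S : VSet n} {u} →
  T (lookup S u ∨ anyF (λ v → lookup S v ∧ adj G u v)) ⇔ Dominated G S u
T-dominated {G = G} {S} {u} = mk⇔ to′ from′
  where
  to′ : T (lookup S u ∨ anyF (λ v → lookup S v ∧ adj G u v)) → Dominated G S u
  to′ h with to T-∨ h
  ... | inj₁ u∈S = member u∈S
  ... | inj₂ h′ with to (T-anyF {f = λ v → lookup S v ∧ adj G u v}) h′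
  ...   | v , q = let (v∈S , uv) = to T-∧ q in adjacent v∈S uv
  from′ : Dominated G S u → T (lookup S u ∨ anyF (λ v → lookup S v ∧ adj G u v))
  from′ (member u∈S) = from T-∨ (inj₁ u∈S)
  from′ (adjacent {v} v∈S uv) =
    from T-∨ (inj₂ (from (T-anyF {f = λ v → lookup S v ∧ adj G u v}) (v , from T-∧ (v∈S , uv))))

T-isDomIn : ∀ {n} {G : Graph n} {U S : VSet n} →
  T (isDomIn G U S) ⇔ (S ⊆ U × (∀ {u} → u ∈ U → Dominated G S u))
T-isDomIn {G = G} {U} {S} = mk⇔
  (λ h → let (S⊆U , dom) = to T-∧ h in
    (λ {v} → to (T-⊆ᵇ {A = S} {U}) S⊆U {v}) ,
    λ {u} u∈U → to (T-dominated {G = G} {S} {u}) (to (T-not-∨ {lookup U u}) (to T-allF dom u) u∈U))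
  (λ (S⊆U , dom) → from T-∧ (from (T-⊆ᵇ {A = S} {U}) (λ {v} → S⊆U {v}) ,
    from T-allF (λ u → from (T-not-∨ {lookup U u}) (λ u∈U → from (T-dominated {G = G} {S} {u}) (dom u∈U)))))

isDomIn-⊆ : ∀ {n} {G : Graph n} {U S : VSet n} → T (isDomIn G U S) → S ⊆ U
isDomIn-⊆ {G = G} {U} {S} dom {v} = proj₁ (to (T-isDomIn {G = G} {U} {S}) dom) {v}

D1In-∑ : ∀ {n} (G : Graph n) (U : VSet n) → D1In G U ≡ ∑⊆ U (⟦_⟧ ∘ isDomIn G U)
D1In-∑ {n} G U = begin
  length (filter (λ S → T? (isDomIn G U S)) (allSubsets n))
    ≡⟨ length-filter (isDomIn G U) (allSubsets n) ⟩
  sum (map (⟦_⟧ ∘ isDomIn G U) (allSubsets n))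
    ≡⟨ sum-allSubsets n _ ⟩
  ∑⊆ fullSet (⟦_⟧ ∘ isDomIn G U)
    ≡⟨ ∑⊆-restrict U _ (λ {A} v∈A v∉U → ⟦⟧-false (λ dom → v∉U (isDomIn-⊆ {G = G} {U} {A} dom v∈A))) ⟩
  ∑⊆ U (⟦_⟧ ∘ isDomIn G U) ∎
  where open ≡-Reasoning

D'1In-∑ : ∀ {n} (G : Graph n) (U : VSet n) → D'1In G U ≡ ∑⊆ U (λ S → ⟦ isDomIn G U S ⟧ * card S)
D'1In-∑ {n} G U = begin
  sum (map card (filter (λ S → T? (isDomIn G U S)) (allSubsets n)))
    ≡⟨ sum-map-filter (isDomIn G U) card (allSubsets n) ⟩
  sum (map (λ S → ⟦ isDomIn G U S ⟧ * card S) (allSubsets n))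
    ≡⟨ sum-allSubsets n _ ⟩
  ∑⊆ fullSet (λ S → ⟦ isDomIn G U S ⟧ * card S)
    ≡⟨ ∑⊆-restrict U _ (λ {A} v∈A v∉U → cong (_* card A)
         (⟦⟧-false (λ dom → v∉U (isDomIn-⊆ {G = G} {U} {A} dom v∈A)))) ⟩
  ∑⊆ U (λ S → ⟦ isDomIn G U S ⟧ * card S) ∎
  where open ≡-Reasoning

D1In-positive : ∀ {n} (G : Graph n) (U : VSet n) → 1 ≤ D1In G U
D1In-positive G U = subst (1 ≤_) (sym (D1In-∑ G U))
  (≤-trans (≤-reflexive (sym (cong ⟦_⟧ U-dominates))) (∑⊆-≥ U (⟦_⟧ ∘ isDomIn G U) {U} (λ {v} u∈U → u∈U)))
  where
  U-dominates : isDomIn G U U ≡ true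
  U-dominates = to T-≡ (from (T-isDomIn {G = G} {U} {U}) ((λ {v} u∈U → u∈U) , member))

T-isLeafB : ∀ {n} {G : Graph n} {v} → T (isLeafB G v) ⇔ IsLeaf G v
T-isLeafB {G = G} {v} with degree G v
... | zero = mk⇔ (λ ()) (λ ())
... | suc zero = mk⇔ (λ _ → refl) (λ _ → tt)
... | suc (suc _) = mk⇔ (λ ()) (λ ())

adj-sym : ∀ {n} (G : Graph n) {u v} → T (adj G u v) → T (adj G v u)
adj-sym G {u} {v} = subst T (Graph.sym G u v)

leaf-neighbour-unique : ∀ {n} (G : Graph n) {v a b} → IsLeaf G v → T (adj G v a) → T (adj G v b) → a ≡ b
leaf-neighbour-unique G {v} leaf = countF≡1-unique (adj G v) leaf

Dominated-mono : ∀ {n} {G : Graph n} {A B : VSet n} {u} → A ⊆ B → Dominated G A u → Dominated G B u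
Dominated-mono A⊆B (member u∈A) = member (A⊆B u∈A)
Dominated-mono A⊆B (adjacent v∈A uv) = adjacent (A⊆B v∈A) uv

leaf-dominated : ∀ {n} {G : Graph n} {S : VSet n} {ℓ u} → Dominating G S →
  IsLeaf G ℓ → T (adj G ℓ u) → u ∉ S → ℓ ∈ S
leaf-dominated {G = G} {S} {ℓ} dom leaf ℓu u∉S with dom ℓ
... | member ℓ∈S = ℓ∈S
... | adjacent v∈S ℓv = ⊥-elim (u∉S (subst (_∈ S) (leaf-neighbour-unique G leaf ℓv ℓu) v∈S))

-- `restVerts` compares vertices with a function local to its where-block, which cannot be
-- named here. `eqᴿ` is that function, the meta being solved by unification in
-- `restVerts-lookup-suc`, whose with-abstractions turn the goal into a pattern problem.
private
  mutual
    eqᴿ : ∀ {n} → Graph n → Fin n → ∀ {m} → Fin m → Fin m → Bool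
    eqᴿ = _

    restVerts-lookup-suc : ∀ {n} (G : Graph (suc n)) (w v : Fin n) →
      lookup (restVerts G (suc w)) (suc v) ≡ not (lookup (leafNbrs G (suc w)) (suc v)) ∧ not (eqᴿ G (suc w) v w)
    restVerts-lookup-suc {n} G w v with tabulate {n = n} (λ u → adj G (suc w) (suc u) ∧ isLeafB G (suc u))
    ... | _ with suc n | G | suc w
    ...   | _ | _ | _ = lookup∘tabulate _ v

  eqᴿ-≟ : ∀ {n} (G : Graph n) (x : Fin n) {m} (a b : Fin m) → eqᴿ G x a b ≡ does (a ≟ b)
  eqᴿ-≟ G x zero zero = refl
  eqᴿ-≟ G x zero (suc b) = refl
  eqᴿ-≟ G x (suc a) zero = refl
  eqᴿ-≟ G x (suc a) (suc b) = eqᴿ-≟ G x a b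

restVerts-lookup : ∀ {n} (G : Graph n) (w v : Fin n) →
  lookup (restVerts G w) v ≡ not (lookup (leafNbrs G w) v) ∧ not (does (v ≟ w))
restVerts-lookup G zero zero = refl
restVerts-lookup G zero (suc v) =
  lookup∘tabulate (λ u → not (lookup (leafNbrs G zero) u) ∧ not (does (u ≟ zero))) (suc v)
restVerts-lookup G (suc w) zero = refl
restVerts-lookup G (suc w) (suc v) =
  trans (restVerts-lookup-suc G w v) (cong (λ b → not (lookup (leafNbrs G (suc w)) (suc v)) ∧ not b) (eqᴿ-≟ G (suc w) v w))

module PendantLeaves {n} (G : Graph n) (w : Fin n) where

  K M : VSet n
  K = leafNbrs G w
  M = restVerts G w

  ∈K⇔ : ∀ {v} → v ∈ K ⇔ (T (adj G w v) × IsLeaf G v)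
  ∈K⇔ {v} = subst (λ b → T b ⇔ (T (adj G w v) × IsLeaf G v))
    (sym (lookup∘tabulate (λ u → adj G w u ∧ isLeafB G u) v))
    (mk⇔ (λ h → let (wv , leaf) = to T-∧ h in wv , to (T-isLeafB {G = G}) leaf)
         (λ (wv , leaf) → from T-∧ (wv , from (T-isLeafB {G = G}) leaf)))

  K-neighbour : ∀ {v u} → v ∈ K → T (adj G v u) → u ≡ w
  K-neighbour v∈K vu = let (wv , leaf) = to ∈K⇔ v∈K in leaf-neighbour-unique G leaf vu (adj-sym G wv)

  w∉K : w ∉ K
  w∉K w∈K = subst T (Graph.irrefl G w) (proj₁ (to ∈K⇔ w∈K))

  ∈M⇔ : ∀ {v} → v ∈ M ⇔ (v ∉ K × v ≢ w)
  ∈M⇔ {v} = subst (λ b → T b ⇔ (v ∉ K × v ≢ w)) (sym (restVerts-lookup G w v)) (T-not∧not {lookup K v} {v ≟ w})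
    where
    T-not∧not : ∀ {k} {d : Dec (v ≡ w)} → T (not k ∧ not (does d)) ⇔ (¬ T k × v ≢ w)
    T-not∧not {true} = mk⇔ (λ ()) (λ (¬k , _) → ⊥-elim (¬k tt))
    T-not∧not {false} {yes v≡w} = mk⇔ (λ ()) (λ (_ , v≢w) → ⊥-elim (v≢w v≡w))
    T-not∧not {false} {no v≢w} = mk⇔ (λ _ → (λ ()) , v≢w) (λ _ → tt)

  K∉M : ∀ {v} → v ∈ K → v ∉ M
  K∉M v∈K v∈M = proj₁ (to ∈M⇔ v∈M) v∈K

  w∉M : w ∉ M
  w∉M w∈M = proj₂ (to ∈M⇔ w∈M) refl

  ∉M⇒ : ∀ {v} → v ∉ M → v ∈ K ⊎ v ≡ w
  ∉M⇒ {v} v∉M with v ∈? K | v ≟ w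
  ... | yes v∈K | _ = inj₁ v∈K
  ... | no _ | yes v≡w = inj₂ v≡w
  ... | no v∉K | no v≢w = ⊥-elim (v∉M (from ∈M⇔ (v∉K , v≢w)))

  ∁M≡K[w]≔true : ∁ M ≡ K [ w ]≔ true
  ∁M≡K[w]≔true = Pointwise-≡⇒≡ (ext λ v →
    trans (lookup-map v not M) (trans (cong not (restVerts-lookup G w v)) (pointwise v)))
    where
    pointwise : ∀ v → not (not (lookup K v) ∧ not (does (v ≟ w))) ≡ lookup (K [ w ]≔ true) v
    pointwise v with v ≟ w
    ... | yes refl = trans (cong not (∧-zeroʳ _)) (sym (lookup∘update w K true))
    ... | no v≢w = trans (cong not (∧-identityʳ _)) (trans (not-involutive _) (sym (lookup∘update′ v≢w K true)))

  -- For B ⊆ K ∪ {w} = ∁ M: B dominates the star K_{1,t} formed by w and its leaves.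
  dominatesStar : VSet n → Bool
  dominatesStar B = lookup B w ∨ K ⊆ᵇ B

  T-dominatesStar : ∀ {B} → T (dominatesStar B) ⇔ (w ∈ B ⊎ K ⊆ B)
  T-dominatesStar {B} = mk⇔
    (λ h → map₂ (λ K⊆B {v} → to (T-⊆ᵇ {A = K} {B}) K⊆B {v}) (to T-∨ h))
    (λ h → from T-∨ (map₂ (λ K⊆B → from (T-⊆ᵇ {A = K} {B}) (λ {v} → K⊆B {v})) h))

  ∑⊆-dominatesStar : (h : VSet n → ℕ) →
    ∑⊆ (∁ M) (λ B → ⟦ dominatesStar B ⟧ * h B) ≡ ∑⊆ K (λ B → h (B [ w ]≔ true)) + h K
  ∑⊆-dominatesStar h = begin
    ∑⊆ (∁ M) (λ B → ⟦ dominatesStar B ⟧ * h B)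
      ≡⟨ cong (λ U → ∑⊆ U (λ B → ⟦ dominatesStar B ⟧ * h B)) ∁M≡K[w]≔true ⟩
    ∑⊆ (K [ w ]≔ true) (λ B → ⟦ dominatesStar B ⟧ * h B)
      ≡⟨ ∑⊆-insert K w _ w∉K ⟩
    ∑⊆ K (λ B → ⟦ dominatesStar (B [ w ]≔ true) ⟧ * h (B [ w ]≔ true)) + ∑⊆ K (λ B → ⟦ dominatesStar B ⟧ * h B)
      ≡⟨ cong₂ _+_ (∑⊆-cong K (λ {B} _ → with-w B)) (∑⊆-cong K without-w) ⟩
    ∑⊆ K (λ B → h (B [ w ]≔ true)) + ∑⊆ K (λ B → ⟦ K ⊆ᵇ B ⟧ * h B)
      ≡⟨ cong (∑⊆ K (λ B → h (B [ w ]≔ true)) +_) (∑⊆-⊇ K h) ⟩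
    ∑⊆ K (λ B → h (B [ w ]≔ true)) + h K ∎
    where
    open ≡-Reasoning
    with-w : ∀ B → ⟦ dominatesStar (B [ w ]≔ true) ⟧ * h (B [ w ]≔ true) ≡ h (B [ w ]≔ true)
    with-w B = trans (cong (λ b → ⟦ b ∨ K ⊆ᵇ (B [ w ]≔ true) ⟧ * h (B [ w ]≔ true)) (lookup∘update w B true))
                     (+-identityʳ _)
    without-w : ∀ {B} → B ⊆ K → ⟦ dominatesStar B ⟧ * h B ≡ ⟦ K ⊆ᵇ B ⟧ * h B
    without-w {B} B⊆K = cong (λ b → ⟦ b ∨ K ⊆ᵇ B ⟧ * h B) (¬T⇒≡false (w∉K ∘ B⊆K))

  starCount starSize : ℕ
  starCount = ∑⊆ (∁ M) (λ B → ⟦ dominatesStar B ⟧)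
  starSize = ∑⊆ (∁ M) (λ B → ⟦ dominatesStar B ⟧ * card B)

  starCount≡ : starCount ≡ 2 ^ card K + 1
  starCount≡ = begin
    starCount
      ≡⟨ ∑⊆-cong (∁ M) (λ {B} _ → sym (*-identityʳ ⟦ dominatesStar B ⟧)) ⟩
    ∑⊆ (∁ M) (λ B → ⟦ dominatesStar B ⟧ * 1)
      ≡⟨ ∑⊆-dominatesStar (λ _ → 1) ⟩
    ∑⊆ K (λ _ → 1) + 1
      ≡⟨ cong (_+ 1) (∑⊆-1 K) ⟩
    2 ^ card K + 1 ∎
    where open ≡-Reasoning

  starSize≡ : 2 * starSize ≡ (2 + card K) * 2 ^ card K + 2 * card K
  starSize≡ = begin
    2 * starSize
      ≡⟨ cong (2 *_) (∑⊆-dominatesStar card) ⟩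
    2 * (∑⊆ K (λ B → card (B [ w ]≔ true)) + card K)
      ≡⟨ cong (λ s → 2 * (s + card K)) (∑⊆-cong K (λ {B} B⊆K → card-insert B w (w∉K ∘ B⊆K))) ⟩
    2 * (∑⊆ K (λ B → 1 + card B) + card K)
      ≡⟨ cong (λ s → 2 * (s + card K)) (∑⊆-+ K (λ _ → 1) card) ⟩
    2 * (∑⊆ K (λ _ → 1) + ∑⊆ K card + card K)
      ≡⟨ cong (λ s → 2 * (s + ∑⊆ K card + card K)) (∑⊆-1 K) ⟩
    2 * (2 ^ card K + ∑⊆ K card + card K)
      ≡⟨ regroup (2 ^ card K) (∑⊆ K card) (card K) ⟩
    2 * 2 ^ card K + 2 * ∑⊆ K card + 2 * card K
      ≡⟨ cong (λ s → 2 * 2 ^ card K + s + 2 * card K) (∑⊆-card K) ⟩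
    2 * 2 ^ card K + card K * 2 ^ card K + 2 * card K
      ≡⟨ cong (_+ 2 * card K) (sym (*-distribʳ-+ (2 ^ card K) 2 (card K))) ⟩
    (2 + card K) * 2 ^ card K + 2 * card K ∎
    where
    open ≡-Reasoning
    regroup : ∀ p s t → 2 * (p + s + t) ≡ 2 * p + 2 * s + 2 * t
    regroup = solve-∀

  module Decomposition (supported : ∀ u → adj G w u ≡ true → ¬ IsLeaf G u → IsSupport G u)
                       {v₁ : Fin n} (v₁∈K : v₁ ∈ K) where

    dominated-via-support : ∀ {S u} → Dominating G S → u ∈ M → u ∉ S → T (adj G u w) → Dominated G (S ∩ M) u
    dominated-via-support {S} {u} dom u∈M u∉S uw =
      via-leaf (supported u (to T-≡ (adj-sym G uw)) λ leaf → u∉K (from ∈K⇔ (adj-sym G uw , leaf)))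
      where
      u∉K : u ∉ K
      u∉K = proj₁ (to ∈M⇔ u∈M)
      u≢w : u ≢ w
      u≢w = proj₂ (to ∈M⇔ u∈M)
      via-leaf : IsSupport G u → Dominated G (S ∩ M) u
      via-leaf (ℓ , uℓ≡true , ℓ-leaf) = adjacent (from (∈-∩ S M) (ℓ∈S , from ∈M⇔ (ℓ∉K , ℓ≢w))) uℓ
        where
        uℓ : T (adj G u ℓ)
        uℓ = from T-≡ uℓ≡true
        ℓ∈S : ℓ ∈ S
        ℓ∈S = leaf-dominated dom ℓ-leaf (adj-sym G uℓ) u∉S
        ℓ∉K : ℓ ∉ K
        ℓ∉K ℓ∈K = u≢w (K-neighbour ℓ∈K (adj-sym G uℓ))
        -- w is no leaf: it is adjacent to u ∉ K and to v₁ ∈ K.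
        ℓ≢w : ℓ ≢ w
        ℓ≢w refl = u∉K (subst (_∈ K) (sym (leaf-neighbour-unique G ℓ-leaf (adj-sym G uℓ) (proj₁ (to ∈K⇔ v₁∈K)))) v₁∈K)

    dominates-H : ∀ {S} → Dominating G S → ∀ {u} → u ∈ M → Dominated G (S ∩ M) u
    dominates-H {S} dom {u} u∈M with u ∈? S | dom u
    ... | yes u∈S | _ = member (from (∈-∩ S M) (u∈S , u∈M))
    ... | no u∉S | member u∈S = ⊥-elim (u∉S u∈S)
    ... | no u∉S | adjacent {v} v∈S uv with v ∈? M
    ...   | yes v∈M = adjacent (from (∈-∩ S M) (v∈S , v∈M)) uv
    ...   | no v∉M with ∉M⇒ v∉M
    ...     | inj₁ v∈K = ⊥-elim (proj₂ (to ∈M⇔ u∈M) (K-neighbour v∈K (adj-sym G uv)))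
    ...     | inj₂ refl = dominated-via-support dom u∈M u∉S uv

    dominates-star : ∀ {S} → Dominating G S → w ∈ S ─ M ⊎ K ⊆ S ─ M
    dominates-star {S} dom with w ∈? S
    ... | yes w∈S = inj₁ (from (∈-─ S M) (w∈S , w∉M))
    ... | no w∉S = inj₂ λ v∈K → let (wv , leaf) = to ∈K⇔ v∈K in
      from (∈-─ S M) (leaf-dominated dom leaf (adj-sym G wv) w∉S , K∉M v∈K)

    dominates-G : ∀ {S} → (∀ {u} → u ∈ M → Dominated G (S ∩ M) u) → w ∈ S ─ M ⊎ K ⊆ S ─ M → Dominating G S
    dominates-G {S} domH star u with u ∈? M
    ... | yes u∈M = Dominated-mono {G = G} {S ∩ M} {S} (p∩q⊆p S M) (domH u∈M)
    ... | no u∉M with ∉M⇒ u∉M | star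
    ...   | inj₁ u∈K | inj₁ w∈B = adjacent (p─q⊆p S M w∈B) (adj-sym G (proj₁ (to ∈K⇔ u∈K)))
    ...   | inj₁ u∈K | inj₂ K⊆B = member (p─q⊆p S M (K⊆B u∈K))
    ...   | inj₂ refl | inj₁ w∈B = member (p─q⊆p S M w∈B)
    ...   | inj₂ refl | inj₂ K⊆B = adjacent (p─q⊆p S M (K⊆B v₁∈K)) (proj₁ (to ∈K⇔ v₁∈K))

    isDomIn-split : ∀ S → isDomIn G fullSet S ≡ isDomIn G M (S ∩ M) ∧ dominatesStar (S ─ M)
    isDomIn-split S = T-injective (mk⇔
      (λ d → let dom = λ u → proj₂ (to (T-isDomIn {G = G} {fullSet} {S}) d) (∈-fullSet u) in
        from T-∧ (from (T-isDomIn {G = G} {M} {S ∩ M}) ((λ {v} v∈ → proj₂ (to (∈-∩ S M {v}) v∈)) , dominates-H dom) ,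
                  from (T-dominatesStar {S ─ M}) (dominates-star dom)))
      (λ h → let (domH , star) = to T-∧ h in
        from (T-isDomIn {G = G} {fullSet} {S})
          ((λ {v} _ → ∈-fullSet v) , λ {u} _ → dominates-G (proj₂ (to (T-isDomIn {G = G} {M} {S ∩ M}) domH))
                                                         (to (T-dominatesStar {S ─ M}) star) u)))

    D1-product : D1 G ≡ D1In G M * starCount
    D1-product = begin
      D1 G
        ≡⟨ D1In-∑ G fullSet ⟩
      ∑⊆ fullSet (⟦_⟧ ∘ isDomIn G fullSet)
        ≡⟨ ∑⊆-cong fullSet (λ {S} _ → trans (cong ⟦_⟧ (isDomIn-split S)) (⟦∧⟧ (isDomIn G M (S ∩ M)) (dominatesStar (S ─ M)))) ⟩
      ∑⊆ fullSet (λ S → ⟦ isDomIn G M (S ∩ M) ⟧ * ⟦ dominatesStar (S ─ M) ⟧)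
        ≡⟨ ∑⊆-∩-─ M (⟦_⟧ ∘ isDomIn G M) (⟦_⟧ ∘ dominatesStar) ⟩
      ∑⊆ M (⟦_⟧ ∘ isDomIn G M) * starCount
        ≡⟨ cong (_* starCount) (sym (D1In-∑ G M)) ⟩
      D1In G M * starCount ∎
      where open ≡-Reasoning

    D'1-product : D'1 G ≡ D'1In G M * starCount + D1In G M * starSize
    D'1-product = begin
      D'1 G
        ≡⟨ D'1In-∑ G fullSet ⟩
      ∑⊆ fullSet (λ S → ⟦ isDomIn G fullSet S ⟧ * card S)
        ≡⟨ ∑⊆-cong fullSet (λ {S} _ → pointwise S) ⟩
      ∑⊆ fullSet (λ S → ⟦ dH (S ∩ M) ⟧ * card (S ∩ M) * ⟦ dS (S ─ M) ⟧ + ⟦ dH (S ∩ M) ⟧ * (⟦ dS (S ─ M) ⟧ * card (S ─ M)))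
        ≡⟨ ∑⊆-+ fullSet (λ S → ⟦ dH (S ∩ M) ⟧ * card (S ∩ M) * ⟦ dS (S ─ M) ⟧)
                        (λ S → ⟦ dH (S ∩ M) ⟧ * (⟦ dS (S ─ M) ⟧ * card (S ─ M))) ⟩
      ∑⊆ fullSet (λ S → ⟦ dH (S ∩ M) ⟧ * card (S ∩ M) * ⟦ dS (S ─ M) ⟧)
        + ∑⊆ fullSet (λ S → ⟦ dH (S ∩ M) ⟧ * (⟦ dS (S ─ M) ⟧ * card (S ─ M)))
        ≡⟨ cong₂ _+_ (∑⊆-∩-─ M (λ A → ⟦ dH A ⟧ * card A) (⟦_⟧ ∘ dS))
                     (∑⊆-∩-─ M (⟦_⟧ ∘ dH) (λ B → ⟦ dS B ⟧ * card B)) ⟩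
      ∑⊆ M (λ A → ⟦ dH A ⟧ * card A) * starCount + ∑⊆ M (⟦_⟧ ∘ dH) * starSize
        ≡⟨ sym (cong₂ (λ x y → x * starCount + y * starSize) (D'1In-∑ G M) (D1In-∑ G M)) ⟩
      D'1In G M * starCount + D1In G M * starSize ∎
      where
      open ≡-Reasoning
      dH = isDomIn G M
      dS = dominatesStar
      distribute : ∀ a b x y → a * b * (x + y) ≡ a * x * b + a * (b * y)
      distribute = solve-∀
      pointwise : ∀ S → ⟦ isDomIn G fullSet S ⟧ * card S
                      ≡ ⟦ dH (S ∩ M) ⟧ * card (S ∩ M) * ⟦ dS (S ─ M) ⟧ + ⟦ dH (S ∩ M) ⟧ * (⟦ dS (S ─ M) ⟧ * card (S ─ M))
      pointwise S = trans (cong₂ _*_ (trans (cong ⟦_⟧ (isDomIn-split S)) (⟦∧⟧ (dH (S ∩ M)) (dS (S ─ M)))) (card-∩-─ S M))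
                          (distribute ⟦ dH (S ∩ M) ⟧ ⟦ dS (S ─ M) ⟧ (card (S ∩ M)) (card (S ─ M)))

+-≤-≡⇒≡ : ∀ {x x′ y y′} → x ≤ x′ → y ≤ y′ → x + y ≡ x′ + y′ → x ≡ x′ × y ≡ y′
+-≤-≡⇒≡ {x} {x′} {y} {y′} x≤x′ y≤y′ eq = x≡x′ , +-cancelˡ-≡ x y y′ (trans eq (cong (_+ y′) (sym x≡x′)))
  where
  x≡x′ : x ≡ x′
  x≡x′ = ≤-antisym x≤x′ (+-cancelʳ-≤ y′ x′ x (≤-trans (≤-reflexive (sym eq)) (+-monoʳ-≤ x y≤y′)))

private
  expand-lhs : ∀ a a′ b b′ → 3 * (a′ * b + a * b′) ≡ 3 * a′ * b + a * (3 * b′)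
  expand-lhs = solve-∀
  expand-rhs : ∀ a b r s → 2 * (r + s) * (a * b) ≡ 2 * r * a * b + a * (2 * s * b)
  expand-rhs = solve-∀

module ProductBound {a a′ b b′ r s : ℕ} (a-bound : 3 * a′ ≤ 2 * r * a) (b-bound : 3 * b′ ≤ 2 * s * b) where

  product-bound : 3 * (a′ * b + a * b′) ≤ 2 * (r + s) * (a * b)
  product-bound = subst₂ _≤_ (sym (expand-lhs a a′ b b′)) (sym (expand-rhs a b r s))
    (+-mono-≤ (*-monoˡ-≤ b a-bound) (*-monoʳ-≤ a b-bound))

  product-bound-≡ : .{{NonZero a}} → .{{NonZero b}} →
    3 * (a′ * b + a * b′) ≡ 2 * (r + s) * (a * b) ⇔ (3 * a′ ≡ 2 * r * a × 3 * b′ ≡ 2 * s * b)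
  product-bound-≡ = mk⇔
    (λ eq → let (eqᵃ , eqᵇ) = +-≤-≡⇒≡ (*-monoˡ-≤ b a-bound) (*-monoʳ-≤ a b-bound)
                                (trans (sym (expand-lhs a a′ b b′)) (trans eq (expand-rhs a b r s)))
            in *-cancelʳ-≡ _ _ b eqᵃ , *-cancelˡ-≡ _ _ a eqᵇ)
    (λ (eqᵃ , eqᵇ) → trans (expand-lhs a a′ b b′)
                       (trans (cong₂ (λ x y → x * b + a * y) eqᵃ eqᵇ) (sym (expand-rhs a b r s))))

-- 2 · 2(t + 1)c − 2 · 3c′ = (t − 2)(2^t − 2), which is positive for t ≥ 3.
star-bound : ∀ t {c c′} → 1 ≤ t → c ≡ 2 ^ t + 1 → 2 * c′ ≡ (2 + t) * 2 ^ t + 2 * t →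
  3 * c′ ≤ 2 * suc t * c × (3 * c′ ≡ 2 * suc t * c ⇔ (t ≡ 1 ⊎ t ≡ 2))
star-bound 1 {c′ = c′} _ refl c′≡ with *-cancelˡ-≡ c′ 4 2 c′≡
... | refl = ≤-refl , mk⇔ (λ _ → inj₁ refl) (λ _ → refl)
star-bound 2 {c′ = c′} _ refl c′≡ with *-cancelˡ-≡ c′ 10 2 c′≡
... | refl = ≤-refl , mk⇔ (λ _ → inj₂ refl) (λ _ → refl)
star-bound t@(suc (suc (suc k))) {c′ = c′} _ refl c′≡ =
  <⇒≤ strict , mk⇔ (λ eq → ⊥-elim (<⇒≢ strict eq)) (λ { (inj₁ ()) ; (inj₂ ()) })
  where
  q : ℕ
  q = pred (2 ^ k)
  2^t≡ : 2 ^ t ≡ 2 * (2 * (2 * suc q))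
  2^t≡ = cong (λ p → 2 * (2 * (2 * p))) (sym (suc-pred (2 ^ k) {{m^n≢0 2 k}}))
  δ : ℕ
  δ = suc (5 + 8 * q + k * (8 * q + 6))
  gap : ∀ k q → 2 * (2 * (4 + k) * (2 * (2 * (2 * suc q)) + 1))
              ≡ 3 * ((5 + k) * (2 * (2 * (2 * suc q))) + 2 * (3 + k)) + suc (5 + 8 * q + k * (8 * q + 6))
  gap = solve-∀
  surplus : 2 * (2 * suc t * (2 ^ t + 1)) ≡ 2 * (3 * c′) + δ
  surplus = begin
    2 * (2 * suc t * (2 ^ t + 1))                        ≡⟨ cong (λ p → 2 * (2 * suc t * (p + 1))) 2^t≡ ⟩
    2 * (2 * suc t * (2 * (2 * (2 * suc q)) + 1))         ≡⟨ gap k q ⟩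
    3 * ((2 + t) * (2 * (2 * (2 * suc q))) + 2 * t) + δ  ≡⟨ cong (λ p → 3 * ((2 + t) * p + 2 * t) + δ) (sym 2^t≡) ⟩
    3 * ((2 + t) * 2 ^ t + 2 * t) + δ                    ≡⟨ cong (λ x → 3 * x + δ) (sym c′≡) ⟩
    3 * (2 * c′) + δ                                     ≡⟨ cong (_+ δ) (trans (sym (*-assoc 3 2 c′)) (*-assoc 2 3 c′)) ⟩
    2 * (3 * c′) + δ                                     ∎
    where open ≡-Reasoning
  strict : 3 * c′ < 2 * suc t * (2 ^ t + 1)
  strict = *-cancelˡ-< 2 (3 * c′) _ (subst (2 * (3 * c′) <_) (sym surplus) (m<m+n _ (s≤s z≤n)))

lemma3p1 : ∀ (n : ℕ) (G : Graph n) (w : Fin n) (t : ℕ) →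
    card (leafNbrs G w) ≡ t → t ≥ 1 →
    (∀ u → adj G w u ≡ true → ¬ IsLeaf G u → IsSupport G u) →
    3 * D'1In G (restVerts G w) ≤ 2 * (n ∸ t ∸ 1) * D1In G (restVerts G w) →
    (3 * D'1 G ≤ 2 * n * D1 G)
    × ((3 * D'1 G ≡ 2 * n * D1 G) ⇔
       ((t ≡ 1 ⊎ t ≡ 2)
        × 3 * D'1In G (restVerts G w) ≡ 2 * (n ∸ t ∸ 1) * D1In G (restVerts G w)))
lemma3p1 n G w _ refl t≥1 supported H-bound =
  subst₂ (Claim n) (sym D'1-product) (sym D1-product) (subst (λ N → Claim N D′ D) order claim)
  where
  open PendantLeaves G w
  open Decomposition supported (proj₂ (countF-witness (lookup K) t≥1))
  t : ℕ
  t = card K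
  Claim : ℕ → ℕ → ℕ → Set
  Claim N D′ D = (3 * D′ ≤ 2 * N * D)
    × ((3 * D′ ≡ 2 * N * D) ⇔ ((t ≡ 1 ⊎ t ≡ 2) × 3 * D'1In G M ≡ 2 * (n ∸ t ∸ 1) * D1In G M))
  order : n ∸ t ∸ 1 + suc t ≡ n
  order = trans (cong (_+ suc t) (trans (∸-+-assoc n t 1) (cong (n ∸_) (+-comm t 1)))) (m∸n+n≡m (card-< K w∉K))
  D′ D : ℕ
  D′ = D'1In G M * starCount + D1In G M * starSize
  D = D1In G M * starCount
  star : 3 * starSize ≤ 2 * suc t * starCount × (3 * starSize ≡ 2 * suc t * starCount ⇔ (t ≡ 1 ⊎ t ≡ 2))
  star = star-bound t {starCount} {starSize} t≥1 starCount≡ starSize≡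
  instance
    H-nonZero : NonZero (D1In G M)
    H-nonZero = >-nonZero (D1In-positive G M)
    star-nonZero : NonZero starCount
    star-nonZero = >-nonZero (subst (0 <_) (trans (+-comm 1 (2 ^ t)) (sym starCount≡)) (s≤s z≤n))
  claim : Claim (n ∸ t ∸ 1 + suc t) D′ D
  claim = product-bound , mk⇔
    (λ eq → let (eqᴴ , eqˢ) = to product-bound-≡ eq in to (proj₂ star) eqˢ , eqᴴ)
    (λ (t∈12 , eqᴴ) → from product-bound-≡ (eqᴴ , from (proj₂ star) t∈12))
    where open ProductBound {D1In G M} {D'1In G M} {starCount} {starSize} {n ∸ t ∸ 1} {suc t} H-bound (proj₁ star)
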